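{- Let $\mathbf h^{(0)},\mathbf h^{(1)}$ be histograms with nonnegative integer counts on a common label universe such that $|h^{(0)}_u-h^{(1)}_u|\le1$ for every label $u$, and let $\bar k\ge1$, $b\in\{0,1\}$. For any $i\in\mathcal D^{\bar k}_\top(\mathbf h^{(b)})\setminus\mathcal D^{\bar k}_\top(\mathbf h^{(1-b)})$ and any $j\in\mathcal D^{\bar k}_\top(\mathbf h^{(1-b)})\setminus\mathcal D^{\bar k}_\top(\mathbf h^{(b)})$ we have $|h^{(b)}_i-h^{(1-b)}_j|\le1$. Furthermore, $|h^{(b)}_{(\bar k+1)}-h^{(1-b)}_{(\bar k+1)}|\le1$.
   Context: For a histogram $\mathbf h$, order the labels so that $h_{i_{(1)}}\ge h_{i_{(2)}}\ge\cdots$, and write $h_{(j)}=h_{i_{(j)}}$ (with $0$ if there are fewer than $j$ labels). The padded top-$\bar k$ domain is $\mathcal D^{\bar k}_\top(\mathbf h)=\{i_{(j)}:j\le\bar k\}\cup\{\bot\}$ if $h_{i_{(\bar k)}}>0$, and, if exactly $p<\bar k$ labels have positive count ($h_{i_{(p)}}>h_{i_{(p+1)}}=0$), $\mathcal D^{\bar k}_\top(\mathbf h)=\{i_{(j)}:j\le p\}\cup\{\top_1,\dots,\top_{\bar k-p}\}\cup\{\bot\}$, where $\top_m$ are dummy labels with count $h_{\top_m}=0$ in every histogram. -}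

module Defs where

open import Data.Nat using (ℕ; zero; suc; _≤_; _<_; _∸_; _<?_)
open import Data.Fin using (Fin; toℕ; fromℕ<)
open import Data.Fin.Permutation using (Permutation′; _⟨$⟩ʳ_; _⟨$⟩ˡ_)
open import Data.List using (List; length; filter; allFin)
open import Relation.Nullary using (yes; no)
open import Relation.Binary.PropositionalEquality using (_≡_)

Histogram : ℕ → Set
Histogram n = Fin n → ℕ

-- A sorting of the labels of h: a permutation σ with
-- i_(j) = σ (j - 1) (positions are 0-based in Fin n) such that
-- h_{i_(1)} ≥ h_{i_(2)} ≥ ⋯ .  Ties may be broken arbitrarily.
record Sorting {n : ℕ} (h : Histogram n) : Set where
  field
    σ    : Permutation′ n
    desc : ∀ (a c : Fin n) → toℕ a ≤ toℕ c → h (σ ⟨$⟩ʳ c) ≤ h (σ ⟨$⟩ʳ a)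

open Sorting public

-- 0-based position of label u in the sorted order (u = i_(pos u + 1)).
pos : ∀ {n} {h : Histogram n} → Sorting h → Fin n → ℕ
pos s u = toℕ (σ s ⟨$⟩ˡ u)

-- Order statistic h_(j), 1-based; 0 when there are fewer than j labels.
ordStat : ∀ {n} {h : Histogram n} → Sorting h → ℕ → ℕ
ordStat         s zero    = 0
ordStat {n} {h} s (suc j) with j <? n
... | yes j<n = h (σ s ⟨$⟩ʳ fromℕ< j<n)
... | no  _   = 0

numPos : ∀ {n} → Histogram n → ℕ
numPos {n} h = length (filter (λ u → 0 <? h u) (allFin n))

-- Elements of a padded domain: genuine labels, dummy labels ⊤_m (m ≥ 1), and ⊥.
data Elem (n : ℕ) : Set where
  lab : Fin n → Elem n
  top : ℕ → Elem n
  bot : Elem n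

cnt : ∀ {n} → Histogram n → Elem n → ℕ
cnt h (lab u) = h u
cnt h (top m) = 0
cnt h bot     = 0

data InDom {n : ℕ} {h : Histogram n} (s : Sorting h) (k : ℕ) : Elem n → Set where
  labBig   : ∀ {u} → 0 < ordStat s k → pos s u < k → InDom s k (lab u)
  labSmall : ∀ {u} → ordStat s k ≡ 0 → pos s u < numPos h → InDom s k (lab u)
  dummy    : ∀ {m} → ordStat s k ≡ 0 → 1 ≤ m → m ≤ k ∸ numPos h → InDom s k (top m)
  botIn    : InDom s k bot

{-# OPTIONS --safe #-}
module Submission where

-- Labels inside a padded top-k̄ domain occupy an initial segment of the sorted
-- order, so every label outside it has at most the count of every label inside
-- it (and count 0 when h_(k̄) = 0, since then all positive labels are inside).
-- Hence for i in the b-domain only and j in the (1−b)-domain only,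
-- h⁽ᵇ⁾_i ≤ h⁽¹⁻ᵇ⁾_i + 1 ≤ h⁽¹⁻ᵇ⁾_j + 1, and symmetrically.  For the order
-- statistics: among the top j̄ labels of one histogram some label has rank ≥ j̄
-- in the other, so perturbing all counts by at most 1 moves h_(j̄) by at most 1.

open import Defs
open import Data.Nat using (ℕ; zero; suc; _+_; _≤_; _<_; ∣_-_∣; z≤n; s≤s; _<?_)
open import Data.Nat.Properties
  using (≤-trans; <⇒≤; ≮⇒≥; n≮n; n≤0⇒n≡0; +-monoˡ-≤; +-monoʳ-≤; m≤∣m-n∣+n; ∣-∣-comm; module ≤-Reasoning)
open import Data.Bool using (Bool; true; false; not)
open import Data.Product using (∃; _×_; _,_; proj₁; proj₂; map₂)
open import Data.Empty using (⊥-elim)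
open import Data.Fin using (Fin; toℕ; fromℕ<; inject≤)
open import Data.Fin.Properties
  using (toℕ<n; toℕ-injective; toℕ≤pred[n]; toℕ-inject≤; toℕ-fromℕ<; inject≤-injective; fromℕ<-injective; injective⇒≤; ¬∀⟶∃¬)
open import Data.Fin.Permutation using (_⟨$⟩ʳ_; _⟨$⟩ˡ_; inverseʳ; inverseˡ)
open import Data.List using (List; length; filter; allFin; lookup)
open import Data.List.Relation.Unary.Any using (index)
open import Data.List.Relation.Unary.Any.Properties using (lookup-index)
open import Data.List.Membership.Propositional using (_∈_)
open import Data.List.Membership.Propositional.Properties using (∈-filter⁺; ∈-allFin)
open import Function using (_∘_)
open import Function.Definitions using (Injective)
import Function.Construct.Composition as Compose
open import Relation.Nullary using (¬_; yes; no)
open import Relation.Binary.PropositionalEquality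
  using (_≡_; sym; trans; cong; subst; subst₂)

∣-∣≤1⇒≤1+ : ∀ m n → ∣ m - n ∣ ≤ 1 → m ≤ 1 + n
∣-∣≤1⇒≤1+ m n d = ≤-trans (m≤∣m-n∣+n m n) (+-monoˡ-≤ n d)

≤1+⇒∣-∣≤1 : ∀ {m n} → m ≤ 1 + n → n ≤ 1 + m → ∣ m - n ∣ ≤ 1
≤1+⇒∣-∣≤1 {zero}  {n}     _       n≤1 = n≤1
≤1+⇒∣-∣≤1 {suc m} {zero}  m≤1     _   = m≤1
≤1+⇒∣-∣≤1 {suc m} {suc n} (s≤s p) (s≤s q) = ≤1+⇒∣-∣≤1 p q

injective⇒≤length : ∀ {a} {A : Set a} {m} {xs : List A} (f : Fin m → A)
  → Injective _≡_ _≡_ f → (∀ c → f c ∈ xs) → m ≤ length xs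
injective⇒≤length {xs = xs} f f-inj mem =
  injective⇒≤ {f = index ∘ mem} λ {c} {d} eq →
    f-inj (trans (lookup-index (mem c)) (trans (cong (lookup xs) eq) (sym (lookup-index (mem d)))))

injective-escapes : ∀ {k n} (f : Fin (suc k) → Fin n) → Injective _≡_ _≡_ f
  → ∃ λ c → k ≤ toℕ (f c)
injective-escapes {k} f f-inj =
  map₂ ≮⇒≥ (¬∀⟶∃¬ (suc k) (λ c → toℕ (f c) < k) (λ c → toℕ (f c) <? k) not-all-below)
  where
  not-all-below : ¬ (∀ c → toℕ (f c) < k)
  not-all-below below = n≮n k (injective⇒≤ {f = λ c → fromℕ< (below c)} λ {c} {d} eq →
    f-inj (toℕ-injective (fromℕ<-injective _ _ (below c) (below d) eq)))

module _ {n : ℕ} {h : Histogram n} (s : Sorting h) where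

  label : Fin n → Fin n
  label a = σ s ⟨$⟩ʳ a

  label-injective : Injective _≡_ _≡_ label
  label-injective eq =
    trans (sym (inverseˡ (σ s))) (trans (cong (σ s ⟨$⟩ˡ_) eq) (inverseˡ (σ s)))

  unlabel-injective : Injective _≡_ _≡_ (σ s ⟨$⟩ˡ_)
  unlabel-injective eq = trans (sym (inverseʳ (σ s))) (trans (cong label eq) (inverseʳ (σ s)))

  pos-label : ∀ a → pos s (label a) ≡ toℕ a
  pos-label a = cong toℕ (inverseˡ (σ s))

  pos-label-fromℕ< : ∀ {k} (k<n : k < n) → pos s (label (fromℕ< k<n)) ≡ k
  pos-label-fromℕ< k<n = trans (pos-label _) (toℕ-fromℕ< k<n)

  pos-antitone : ∀ {u v} → pos s u ≤ pos s v → h v ≤ h u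
  pos-antitone le =
    subst₂ (λ x y → h x ≤ h y) (inverseʳ (σ s)) (inverseʳ (σ s)) (desc s _ _ le)

  -- the labels ranked at or above a positive label are positive and distinct
  positive⇒pos<numPos : ∀ {v} → 0 < h v → pos s v < numPos h
  positive⇒pos<numPos {v} 0<hv =
    injective⇒≤length above
      (Compose.injective _≡_ _≡_ _≡_ (inject≤-injective v<n v<n _ _) label-injective) λ c →
        ∈-filter⁺ (λ u → 0 <? h u) (∈-allFin (above c)) (≤-trans 0<hv (pos-antitone (above≤v c)))
    where
    v<n : pos s v < n
    v<n = toℕ<n (σ s ⟨$⟩ˡ v)

    above : Fin (suc (pos s v)) → Fin n
    above c = label (inject≤ c v<n)

    above≤v : ∀ c → pos s (above c) ≤ pos s v
    above≤v c = subst (_≤ pos s v) (sym (trans (pos-label _) (toℕ-inject≤ c _))) (toℕ≤pred[n] c)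

  outside-dominated : ∀ {k u v} → InDom s k (lab u) → ¬ InDom s k (lab v) → h v ≤ h u
  outside-dominated {k} {v = v} (labBig 0<hₖ u<k) v∉ with pos s v <? k
  ... | yes v<k = ⊥-elim (v∉ (labBig 0<hₖ v<k))
  ... | no  v≮k = pos-antitone (≤-trans (<⇒≤ u<k) (≮⇒≥ v≮k))
  outside-dominated {v = v} (labSmall hₖ≡0 u<p) v∉ with pos s v <? numPos h
  ... | yes v<p = ⊥-elim (v∉ (labSmall hₖ≡0 v<p))
  ... | no  v≮p = pos-antitone (≤-trans (<⇒≤ u<p) (≮⇒≥ v≮p))

  outside-vanishes : ∀ {k v} → ordStat s k ≡ 0 → ¬ InDom s k (lab v) → h v ≡ 0
  outside-vanishes hₖ≡0 v∉ = n≤0⇒n≡0 (≮⇒≥ (v∉ ∘ labSmall hₖ≡0 ∘ positive⇒pos<numPos))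

ordStat-shift : ∀ {n d} {A B : Histogram n} (sA : Sorting A) (sB : Sorting B)
  → (∀ u → A u ≤ d + B u) → ∀ j → ordStat sA j ≤ d + ordStat sB j
ordStat-shift sA sB A≤B zero = z≤n
ordStat-shift {n} {d} {A} {B} sA sB A≤B (suc k) with k <? n
... | no  _   = z≤n
... | yes k<n = begin
  A (label sA kth)   ≤⟨ pos-antitone sA x≤k ⟩
  A x                ≤⟨ A≤B x ⟩
  d + B x            ≤⟨ +-monoʳ-≤ d (pos-antitone sB k≤x) ⟩
  d + B (label sB kth) ∎
  where
  open ≤-Reasoning

  kth : Fin n
  kth = fromℕ< k<n

  topA : Fin (suc k) → Fin n
  topA c = label sA (inject≤ c k<n)

  escape : ∃ λ c → k ≤ pos sB (topA c)
  escape = injective-escapes ((σ sB ⟨$⟩ˡ_) ∘ topA)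
    (Compose.injective _≡_ _≡_ _≡_
      (Compose.injective _≡_ _≡_ _≡_ (inject≤-injective k<n k<n _ _) (label-injective sA))
      (unlabel-injective sB))

  c : Fin (suc k)
  c = proj₁ escape

  x : Fin n
  x = topA c

  x≤k : pos sA x ≤ pos sA (label sA kth)
  x≤k = begin
    pos sA x          ≡⟨ trans (pos-label sA _) (toℕ-inject≤ c k<n) ⟩
    toℕ c             ≤⟨ toℕ≤pred[n] c ⟩
    k                 ≡⟨ pos-label-fromℕ< sA k<n ⟨
    pos sA (label sA kth) ∎

  k≤x : pos sB (label sB kth) ≤ pos sB x
  k≤x = subst (_≤ pos sB x) (sym (pos-label-fromℕ< sB k<n)) (proj₂ escape)

record Close {n : ℕ} (A B : Histogram n) : Set where
  constructor close
  field distance≤1 : ∀ u → ∣ A u - B u ∣ ≤ 1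

Close-sym : ∀ {n} {A B : Histogram n} → Close A B → Close B A
Close-sym {A = A} {B} (close d) = close λ u → subst (_≤ 1) (∣-∣-comm (A u) (B u)) (d u)

Close⇒≤1+ : ∀ {n} {A B : Histogram n} → Close A B → ∀ u → A u ≤ 1 + B u
Close⇒≤1+ {A = A} {B} (close d) u = ∣-∣≤1⇒≤1+ (A u) (B u) (d u)

ordStat-close : ∀ {n} {A B : Histogram n} (sA : Sorting A) (sB : Sorting B)
  → Close A B → ∀ j → ∣ ordStat sA j - ordStat sB j ∣ ≤ 1
ordStat-close sA sB A≈B j = ≤1+⇒∣-∣≤1
  (ordStat-shift sA sB (Close⇒≤1+ A≈B) j)
  (ordStat-shift sB sA (Close⇒≤1+ (Close-sym A≈B)) j)

domain-difference-close : ∀ {n} {A B : Histogram n} (sA : Sorting A) (sB : Sorting B)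
  → Close A B → ∀ k (i j : Elem n)
  → InDom sA k i → ¬ InDom sB k i → InDom sB k j → ¬ InDom sA k j
  → ∣ cnt A i - cnt B j ∣ ≤ 1
domain-difference-close sA sB A≈B k bot j _ i∉B _ _ = ⊥-elim (i∉B botIn)
domain-difference-close sA sB A≈B k i bot _ _ _ j∉A = ⊥-elim (j∉A botIn)
domain-difference-close sA sB A≈B k (lab u) (lab v) u∈A u∉B v∈B v∉A = ≤1+⇒∣-∣≤1
  (≤-trans (Close⇒≤1+ A≈B u) (s≤s (outside-dominated sB v∈B u∉B)))
  (≤-trans (Close⇒≤1+ (Close-sym A≈B) v) (s≤s (outside-dominated sA u∈A v∉A)))
domain-difference-close {B = B} sA sB A≈B k (top _) (lab v) (dummy Aₖ≡0 _ _) _ _ v∉A =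
  subst (λ a → B v ≤ 1 + a) (outside-vanishes sA Aₖ≡0 v∉A) (Close⇒≤1+ (Close-sym A≈B) v)
domain-difference-close {A = A} sA sB A≈B k (lab u) (top _) _ u∉B (dummy Bₖ≡0 _ _) _ = ≤1+⇒∣-∣≤1
  (subst (λ b → A u ≤ 1 + b) (outside-vanishes sB Bₖ≡0 u∉B) (Close⇒≤1+ A≈B u)) z≤n
domain-difference-close sA sB A≈B k (top _) (top _) _ _ _ _ = z≤n

mainTheorem11 : ∀ {n : ℕ} (H : Bool → Histogram n)
    → (∀ u → ∣ H false u - H true u ∣ ≤ 1)
    → (s : (c : Bool) → Sorting (H c))
    → (k : ℕ) → 1 ≤ k → (b : Bool)
    → ((i j : Elem n)
        → InDom (s b) k i → ¬ InDom (s (not b)) k i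
        → InDom (s (not b)) k j → ¬ InDom (s b) k j
        → ∣ cnt (H b) i - cnt (H (not b)) j ∣ ≤ 1)
      × (∣ ordStat (s b) (suc k) - ordStat (s (not b)) (suc k) ∣ ≤ 1)
mainTheorem11 H H₀≈H₁ s k _ b =
  domain-difference-close (s b) (s (not b)) (H≈H′ b) k ,
  ordStat-close (s b) (s (not b)) (H≈H′ b) (suc k)
  where
  H≈H′ : ∀ c → Close (H c) (H (not c))
  H≈H′ false = close H₀≈H₁
  H≈H′ true  = Close-sym (close H₀≈H₁)
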